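{- Let $p$ be an odd prime. For $u \not\equiv 0 \pmod p$ let $A_u := \{(x, x^2/u) : x \in \mathbb{Z}/p\mathbb{Z}\} \subseteq \mathbb{Z}/p\mathbb{Z}\times\mathbb{Z}/p\mathbb{Z}$, and for $uv \not\equiv 0 \pmod p$ and $(a,b)\in(\mathbb{Z}/p\mathbb{Z})^2$ let $r_{A_u - A_v}(a,b)$ be the number of pairs $(x,y)\in(\mathbb{Z}/p\mathbb{Z})^2$ with $a \equiv x - y$ and $b \equiv x^2/u - y^2/v \pmod p$. Let $(a,b)\not\equiv(0,0)\pmod p$. Then: (1) if $u \equiv v \pmod p$, then $r_{A_u - A_v}(a,b) \le 1$; (2) if $u,v,u',v'$ are nonzero mod $p$ with $u - v \equiv u' - v' \pmod p$ and $\left(\frac{uvu'v'}{p}\right) = -1$, then $r_{A_u - A_v}(a,b) + r_{A_{u'} - A_{v'}}(a,b) = 2$ for all $(a,b)\not\equiv(0,0)\pmod p$.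
   Context: $\left(\frac{\cdot}{p}\right)$ denotes the Legendre symbol; division by $u$ means multiplication by the inverse of $u$ modulo $p$. -}

module Defs where

open import Data.Nat using (ℕ; zero; suc; _+_; _*_; _∸_; _≟_; NonZero)
open import Data.Nat.DivMod using (_%_)
open import Data.Fin using (Fin; toℕ; fromℕ<)
open import Data.Fin.Properties using (all?)
open import Data.List using (List; []; _∷_; filter; length; allFin) renaming (_++_ to _++ₗ_)
open import Data.List as L using (map; concatMap)
open import Data.Product using (_×_; _,_; ∃; Σ)
open import Data.Integer using (ℤ; +_; -_)
open import Relation.Nullary using (Dec; yes; no; ¬_)
open import Relation.Nullary.Decidable using (_×-dec_)
open import Relation.Binary.PropositionalEquality using (_≡_)
open import Data.Fin.Properties using (any?)

-- Residues modulo p are represented by Fin p (canonical representatives 0..p-1),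
-- i.e. Z/pZ.  Arithmetic is done on representatives and reduced mod p.
ZMod : ℕ → Set
ZMod p = Fin p

module _ (p : ℕ) .{{_ : NonZero p}} where

  [_] : ℕ → ZMod p
  [ n ] = fromℕ< (Data.Nat.DivMod.m%n<n n p)

  _+ₚ_ : ZMod p → ZMod p → ZMod p
  x +ₚ y = [ toℕ x + toℕ y ]

  _*ₚ_ : ZMod p → ZMod p → ZMod p
  x *ₚ y = [ toℕ x * toℕ y ]

  _-ₚ_ : ZMod p → ZMod p → ZMod p
  x -ₚ y = [ toℕ x + (p ∸ toℕ y) ]

  sq : ZMod p → ZMod p
  sq x = x *ₚ x

  -- the multiplicative inverse of u: the (least) w with u*w ≡ 1 (mod p),
  -- found by search; (0 if none exists, which never happens for u ≢ 0, p prime)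
  invSearch : ZMod p → List (ZMod p) → ZMod p
  invSearch u [] = [ 0 ]
  invSearch u (w ∷ ws) with toℕ (u *ₚ w) ≟ toℕ [ 1 ]
  ... | yes _ = w
  ... | no  _ = invSearch u ws

  inv : ZMod p → ZMod p
  inv u = invSearch u (allFin p)

  _/ₚ_ : ZMod p → ZMod p → ZMod p
  x /ₚ u = x *ₚ inv u

  isZero : ZMod p → Set
  isZero x = toℕ x ≡ 0

  legendre : ZMod p → ℤ
  legendre n with toℕ n ≟ 0
  ... | yes _ = + 0
  ... | no  _ with any? (λ x → toℕ (sq x) ≟ toℕ n)
  ...   | yes _ = + 1
  ...   | no  _ = - (+ 1)

  allPairs : List (ZMod p × ZMod p)
  allPairs = concatMap (λ x → map (λ y → (x , y)) (allFin p)) (allFin p)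

  r : ZMod p → ZMod p → ZMod p → ZMod p → ℕ
  r u v a b = length (filter
    (λ { (x , y) → (toℕ a ≟ toℕ (x -ₚ y)) ×-dec
                   (toℕ b ≟ toℕ ((sq x /ₚ u) -ₚ (sq y /ₚ v))) })
    allPairs)

module Submission where

-- The pair (x, y) is forced to be (x, x - a), so r(u,v;a,b) counts the
-- x ∈ Z/pZ with b = x²/u - (x - a)²/v.  Clearing denominators:
--   * if u = v the condition is linear, 2a·x = a² + b·u, so it has at most
--     one solution when a ≠ 0 and none when a = 0, b ≠ 0  (part 1);
--   * if u ≠ v the substitution z = (v - u)x + a·u is a bijection and turns
--     the condition into z² = uv(a² + b(v - u)), so r is the number of square
--     roots of d = uv·c with c = a² + b(v - u).
-- For part 2, u - v = u′ - v′ makes c common to both pairs and forces u ≠ v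
-- (else uvu′v′ = (uu′)² would be a square).  If c = 0 both counts are 1;
-- otherwise uvc · u′v′c = (uvu′v′)·c² with uvu′v′ a non-residue, so exactly
-- one of d, d′ is a nonzero square (a product of two non-residues is a
-- residue), giving 2 + 0.

open import Defs
open import Data.Nat using (ℕ; _≤_; NonZero)
open import Data.Nat.Primality using (Prime)
open import Data.Fin using (Fin; zero; suc; toℕ)
open import Data.Integer using (ℤ; +_; -_; -[1+_])
open import Data.Product using (Σ; _×_; _,_; proj₁; proj₂)
open import Data.Sum using (_⊎_; inj₁; inj₂)
open import Data.Empty using (⊥-elim)
open import Data.List using (_∷_; allFin; tabulate; filter; length; map; concatMap)
open import Data.List.Relation.Unary.Any using (Any; here; there)
open import Data.List.Membership.Propositional.Properties using (∈-allFin)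
open import Relation.Nullary using (¬_; Dec; yes; no; ¬?)
open import Relation.Nullary.Decidable using (_×-dec_)
open import Relation.Binary.PropositionalEquality using (_≡_; _≢_; refl; sym; trans; cong; cong₂; subst)
open import Function using (_∘_; id)
open import Data.Integer.Tactic.RingSolver using (solve-∀)

import Data.Nat as Nat
import Data.Nat.Properties as ℕₚ
import Data.Nat.DivMod as DivMod
import Data.Nat.Divisibility as Divisibility
import Data.Nat.Primality as Primality
import Data.Nat.Coprimality as Coprimality
import Data.Nat.GCD as GCD
import Data.Integer.Properties as ℤₚ
import Data.Fin.Properties as Finₚ
import Data.List.Relation.Unary.Any as Any
import Data.List.Properties as Listₚ

module Congruence (m : ℕ) where
  open import Data.Integer using (_+_; _*_; _-_)

  infix 4 _≋_
  record _≋_ (x y : ℤ) : Set where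
    constructor _,_
    field
      quotient : ℤ
      difference : x - y ≡ quotient * + m

  -- The basic inference rule: X ≋ Y follows from congruences Xᵢ ≋ Yᵢ as soon
  -- as X - Y = Σ cᵢ·(Xᵢ - Yᵢ) holds in ℤ.  The identity is a pure ring
  -- identity, so in applications it is supplied by the ring solver.
  combine₀ : ∀ {X Y} → X - Y ≡ + 0 → X ≋ Y
  combine₀ e = + 0 , e

  combine₁ : ∀ {X Y X₁ Y₁} c → X₁ ≋ Y₁ → X - Y ≡ c * (X₁ - Y₁) → X ≋ Y
  combine₁ c (k , e) eq = c * k , trans eq (trans (cong (c *_) e) (shift c k (+ m)))
    where
    shift : ∀ c k q → c * (k * q) ≡ (c * k) * q
    shift = solve-∀

  combine₂ : ∀ {X Y X₁ Y₁ X₂ Y₂} c₁ c₂ → X₁ ≋ Y₁ → X₂ ≋ Y₂ →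
             X - Y ≡ c₁ * (X₁ - Y₁) + c₂ * (X₂ - Y₂) → X ≋ Y
  combine₂ c₁ c₂ (k₁ , e₁) (k₂ , e₂) eq =
    c₁ * k₁ + c₂ * k₂ ,
    trans eq (trans (cong₂ (λ s t → c₁ * s + c₂ * t) e₁ e₂) (collect c₁ c₂ k₁ k₂ (+ m)))
    where
    collect : ∀ c₁ c₂ k₁ k₂ q → c₁ * (k₁ * q) + c₂ * (k₂ * q) ≡ (c₁ * k₁ + c₂ * k₂) * q
    collect = solve-∀

  combine₃ : ∀ {X Y X₁ Y₁ X₂ Y₂ X₃ Y₃} c₁ c₂ c₃ → X₁ ≋ Y₁ → X₂ ≋ Y₂ → X₃ ≋ Y₃ →
             X - Y ≡ c₁ * (X₁ - Y₁) + c₂ * (X₂ - Y₂) + c₃ * (X₃ - Y₃) → X ≋ Y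
  combine₃ c₁ c₂ c₃ (k₁ , e₁) (k₂ , e₂) (k₃ , e₃) eq =
    c₁ * k₁ + c₂ * k₂ + c₃ * k₃ ,
    trans eq (trans (cong₂ (λ s t → s + c₃ * t) (cong₂ (λ s t → c₁ * s + c₂ * t) e₁ e₂) e₃)
                    (collect c₁ c₂ c₃ k₁ k₂ k₃ (+ m)))
    where
    collect : ∀ c₁ c₂ c₃ k₁ k₂ k₃ q →
      c₁ * (k₁ * q) + c₂ * (k₂ * q) + c₃ * (k₃ * q) ≡ (c₁ * k₁ + c₂ * k₂ + c₃ * k₃) * q
    collect = solve-∀

  ≋-refl : ∀ {X} → X ≋ X
  ≋-refl {X} = combine₀ (ℤₚ.i≡j⇒i-j≡0 {X} refl)

  ≋-reflexive : ∀ {X Y} → X ≡ Y → X ≋ Y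
  ≋-reflexive refl = ≋-refl

  ≋-sym : ∀ {X Y} → X ≋ Y → Y ≋ X
  ≋-sym {X} {Y} h = combine₁ (- (+ 1)) h (flip X Y)
    where
    flip : ∀ x y → y - x ≡ - (+ 1) * (x - y)
    flip = solve-∀

  ≋-trans : ∀ {X Y Z} → X ≋ Y → Y ≋ Z → X ≋ Z
  ≋-trans {X} {Y} {Z} h₁ h₂ = combine₂ (+ 1) (+ 1) h₁ h₂ (telescope X Y Z)
    where
    telescope : ∀ x y z → x - z ≡ + 1 * (x - y) + + 1 * (y - z)
    telescope = solve-∀

  ≋-+ : ∀ {X Y Z W} → X ≋ Y → Z ≋ W → X + Z ≋ Y + W
  ≋-+ {X} {Y} {Z} {W} h₁ h₂ = combine₂ (+ 1) (+ 1) h₁ h₂ (split X Y Z W)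
    where
    split : ∀ x y z w → (x + z) - (y + w) ≡ + 1 * (x - y) + + 1 * (z - w)
    split = solve-∀

  ≋-- : ∀ {X Y Z W} → X ≋ Y → Z ≋ W → X - Z ≋ Y - W
  ≋-- {X} {Y} {Z} {W} h₁ h₂ = combine₂ (+ 1) (- (+ 1)) h₁ h₂ (split X Y Z W)
    where
    split : ∀ x y z w → (x - z) - (y - w) ≡ + 1 * (x - y) + - (+ 1) * (z - w)
    split = solve-∀

  ≋-* : ∀ {X Y Z W} → X ≋ Y → Z ≋ W → X * Z ≋ Y * W
  ≋-* {X} {Y} {Z} {W} h₁ h₂ = combine₂ Z Y h₁ h₂ (split X Y Z W)
    where
    split : ∀ x y z w → (x * z) - (y * w) ≡ z * (x - y) + y * (z - w)
    split = solve-∀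

  multiple≋0 : ∀ k → k * + m ≋ + 0
  multiple≋0 k = k , ℤₚ.+-identityʳ _

  ≋-plus-multiple : ∀ x k → x ≋ x + k * + m
  ≋-plus-multiple x k = - k , rearrange x k (+ m)
    where
    rearrange : ∀ a q r → a - (a + q * r) ≡ (- q) * r
    rearrange = solve-∀

module Residues (p : ℕ) .{{_ : NonZero p}} where
  open Congruence p public
  open import Data.Integer using (_+_; _*_; _-_)

  ι : ZMod p → ℤ
  ι x = + toℕ x

  infixl 6 _⊕_ _⊖_
  infixl 7 _⊗_
  _⊕_ _⊗_ _⊖_ : ZMod p → ZMod p → ZMod p
  x ⊕ y = _+ₚ_ p x y
  x ⊗ y = _*ₚ_ p x y
  x ⊖ y = _-ₚ_ p x y

  ⟦_⟧ : ℕ → ZMod p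
  ⟦ n ⟧ = [_] p n

  𝟘 : ZMod p
  𝟘 = ⟦ 0 ⟧

  n%p≋n : ∀ n → + (n DivMod.% p) ≋ + n
  n%p≋n n = ≋-trans (≋-plus-multiple _ (+ (n DivMod./ p))) (≋-reflexive (sym n≡))
    where
    n≡ : + n ≡ + (n DivMod.% p) + + (n DivMod./ p) * + p
    n≡ = trans (cong +_ (DivMod.m≡m%n+[m/n]*n n p))
           (trans (ℤₚ.pos-+ (n DivMod.% p) _) (cong (λ t → + (n DivMod.% p) + t) (ℤₚ.pos-* (n DivMod./ p) p)))

  ι-⟦⟧ : ∀ n → ι ⟦ n ⟧ ≋ + n
  ι-⟦⟧ n = ≋-trans (≋-reflexive (cong +_ (Finₚ.toℕ-fromℕ< (DivMod.m%n<n n p)))) (n%p≋n n)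

  ι𝟘 : ι 𝟘 ≋ + 0
  ι𝟘 = ι-⟦⟧ 0

  ι-⊕ : ∀ x y → ι (x ⊕ y) ≋ ι x + ι y
  ι-⊕ x y = ≋-trans (ι-⟦⟧ _) (≋-reflexive (ℤₚ.pos-+ (toℕ x) (toℕ y)))

  ι-⊗ : ∀ x y → ι (x ⊗ y) ≋ ι x * ι y
  ι-⊗ x y = ≋-trans (ι-⟦⟧ _) (≋-reflexive (ℤₚ.pos-* (toℕ x) (toℕ y)))

  ι-⊖ : ∀ x y → ι (x ⊖ y) ≋ ι x - ι y
  ι-⊖ x y = ≋-trans (ι-⟦⟧ _) (≋-trans (≋-reflexive lift) (+ 1 , cancel (ι x) (+ p) (ι y)))
    where
    y≤p : toℕ y Nat.≤ p
    y≤p = ℕₚ.<⇒≤ (Finₚ.toℕ<n y)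
    lift : + (toℕ x Nat.+ (p Nat.∸ toℕ y)) ≡ ι x + (+ p - ι y)
    lift = trans (ℤₚ.pos-+ (toℕ x) _)
             (cong (λ t → ι x + t) (sym (trans (ℤₚ.m-n≡m⊖n p (toℕ y)) (ℤₚ.⊖-≥ y≤p))))
    cancel : ∀ x q y → (x + (q - y)) - (x - y) ≡ + 1 * q
    cancel = solve-∀

  ι-sq : ∀ z → ι (sq p z) ≋ ι z * ι z
  ι-sq z = ι-⊗ z z

  ι-injective : ∀ {x y} → ι x ≋ ι y → x ≡ y
  ι-injective {x} {y} h = Finₚ.toℕ-injective (trans (sym (mod x)) (trans (same-mod _ _ h) (mod y)))
    where
    mod : ∀ (x : ZMod p) → toℕ x DivMod.% p ≡ toℕ x
    mod x = DivMod.m<n⇒m%n≡m (Finₚ.toℕ<n x)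
    from-quotient : ∀ X Y k → + X - + Y ≡ + k * + p → X DivMod.% p ≡ Y DivMod.% p
    from-quotient X Y k e =
      trans (cong (DivMod._% p) X≡) (trans (cong (DivMod._% p) (ℕₚ.+-comm (k Nat.* p) Y))
                                            (DivMod.[m+kn]%n≡m%n Y k p))
      where
      add-back : ∀ x y → x ≡ (x - y) + y
      add-back = solve-∀
      X≡ : X ≡ k Nat.* p Nat.+ Y
      X≡ = ℤₚ.+-injective (trans (add-back (+ X) (+ Y))
             (trans (cong (λ t → t + + Y) (trans e (sym (ℤₚ.pos-* k p)))) (sym (ℤₚ.pos-+ (k Nat.* p) Y))))
    same-mod : ∀ X Y → + X ≋ + Y → X DivMod.% p ≡ Y DivMod.% p
    same-mod X Y (+_ k , e) = from-quotient X Y k e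
    same-mod X Y (-[1+ k ] , e) = sym (from-quotient Y X (Nat.suc k) (swap (+ X) (+ Y) e))
      where
      swap : ∀ a b → a - b ≡ -[1+ k ] * + p → b - a ≡ + Nat.suc k * + p
      swap a b e = trans (flip a b) (trans (cong (λ t → - (+ 1) * t) e) (negate -[1+ k ] (+ p)))
        where
        flip : ∀ a b → b - a ≡ - (+ 1) * (a - b)
        flip = solve-∀
        negate : ∀ k q → - (+ 1) * (k * q) ≡ (- k) * q
        negate = solve-∀

  ≢𝟘⇒≉0 : ∀ {x} → x ≢ 𝟘 → ¬ (ι x ≋ + 0)
  ≢𝟘⇒≉0 x≢𝟘 x≋0 = x≢𝟘 (ι-injective (≋-trans x≋0 (≋-sym ι𝟘)))

  isZero⇒≋0 : ∀ {x} → isZero p x → ι x ≋ + 0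
  isZero⇒≋0 e = ≋-reflexive (cong +_ e)

  ≋0⇒isZero : ∀ {x} → ι x ≋ + 0 → isZero p x
  ≋0⇒isZero {x} h = trans (cong toℕ (ι-injective (≋-trans h (≋-sym ι𝟘)))) toℕ-𝟘
    where
    toℕ-𝟘 : toℕ 𝟘 ≡ 0
    toℕ-𝟘 = trans (Finₚ.toℕ-fromℕ< (DivMod.m%n<n 0 p)) (DivMod.m<n⇒m%n≡m (Nat.>-nonZero⁻¹ p))

module Representatives (p : ℕ) .{{_ : NonZero p}} where
  open Residues p
  open import Data.Integer.DivMod using (_%ℕ_; _/ℕ_; a≡a%ℕn+[a/ℕn]*n)

  residue : ℤ → ZMod p
  residue s = ⟦ s %ℕ p ⟧

  ι-residue : ∀ s → ι (residue s) ≋ s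
  ι-residue s = ≋-trans (ι-⟦⟧ (s %ℕ p))
    (≋-trans (≋-plus-multiple _ (s /ℕ p)) (≋-reflexive (sym (a≡a%ℕn+[a/ℕn]*n s p))))

module PrimeField (p : ℕ) .{{_ : NonZero p}} (p-prime : Prime p) where
  open Residues p
  open Representatives p
  open import Data.Integer using (_+_; _*_; _-_; ∣_∣)

  ≋0⇒p∣ : ∀ {x} → x ≋ + 0 → p Divisibility.∣ ∣ x ∣
  ≋0⇒p∣ {x} (k , e) =
    Divisibility.divides ∣ k ∣ (trans (cong ∣_∣ (trans (sym (ℤₚ.+-identityʳ x)) e)) (ℤₚ.abs-* k (+ p)))

  p∣⇒≋0 : ∀ x → p Divisibility.∣ ∣ x ∣ → x ≋ + 0
  p∣⇒≋0 (+ n) (Divisibility.divides q e) =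
    + q , trans (ℤₚ.+-identityʳ _) (trans (cong +_ e) (ℤₚ.pos-* q p))
  p∣⇒≋0 -[1+ n ] (Divisibility.divides q e) =
    - (+ q) , trans (ℤₚ.+-identityʳ _) (trans (cong (λ t → - (+ t)) e)
                     (trans (cong -_ (ℤₚ.pos-* q p)) (ℤₚ.neg-distribˡ-* (+ q) (+ p))))

  integral : ∀ {x y} → x * y ≋ + 0 → x ≋ + 0 ⊎ y ≋ + 0
  integral {x} {y} h
    with Primality.euclidsLemma ∣ x ∣ ∣ y ∣ p-prime (subst (p Divisibility.∣_) (ℤₚ.abs-* x y) (≋0⇒p∣ h))
  ... | inj₁ p∣x = inj₁ (p∣⇒≋0 x p∣x)
  ... | inj₂ p∣y = inj₂ (p∣⇒≋0 y p∣y)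

  nonzero-* : ∀ {x y} → ¬ (x ≋ + 0) → ¬ (y ≋ + 0) → ¬ (x * y ≋ + 0)
  nonzero-* x≉0 y≉0 h with integral h
  ... | inj₁ x≋0 = x≉0 x≋0
  ... | inj₂ y≋0 = y≉0 y≋0

  cancelˡ : ∀ {c x y} → ¬ (c ≋ + 0) → c * x ≋ c * y → x ≋ y
  cancelˡ {c} {x} {y} c≉0 h with integral {c} {x - y} (combine₁ (+ 1) h (factor c x y))
    where
    factor : ∀ c x y → c * (x - y) - + 0 ≡ + 1 * (c * x - c * y)
    factor = solve-∀
  ... | inj₁ c≋0 = ⊥-elim (c≉0 c≋0)
  ... | inj₂ x-y≋0 = combine₁ (+ 1) x-y≋0 (shift x y)
    where
    shift : ∀ x y → x - y ≡ + 1 * (x - y - + 0)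
    shift = solve-∀

  two≉0 : p ≢ 2 → ¬ (+ 2 ≋ + 0)
  two≉0 p≢2 h with Primality.irreducible[2] (≋0⇒p∣ h)
  ... | inj₁ refl = Primality.¬prime[1] p-prime
  ... | inj₂ p≡2 = p≢2 p≡2

  inverse-exists : ∀ u → ¬ isZero p u → Σ (ZMod p) (λ w → ι u * ι w ≋ + 1)
  inverse-exists u u≢0 with Coprimality.coprime-Bézout coprime
    where
    coprime : Coprimality.Coprime (toℕ u) p
    coprime (d∣u , d∣p) with Primality.prime⇒irreducible p-prime d∣p
    ... | inj₁ d≡1 = d≡1
    ... | inj₂ refl = ⊥-elim (ℕₚ.<⇒≱ (Finₚ.toℕ<n u) (Divisibility.∣⇒≤ {{Nat.≢-nonZero u≢0}} d∣u))
  ... | GCD.Bézout.+- x y eq = residue (+ x) , ≋-trans (≋-* (≋-refl {ι u}) (ι-residue (+ x))) by-eq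
    where
    by-eq : ι u * + x ≋ + 1
    by-eq = combine₂ (- (+ 1)) (+ 1) (≋-reflexive (lift eq)) (multiple≋0 (+ y)) (rearrange (ι u) (+ x) (+ y) (+ p))
      where
      lift : 1 Nat.+ y Nat.* p ≡ x Nat.* toℕ u → + 1 + + y * + p ≡ + x * ι u
      lift e = trans (sym (trans (ℤₚ.pos-+ 1 _) (cong (λ t → + 1 + t) (ℤₚ.pos-* y p))))
                     (trans (cong +_ e) (ℤₚ.pos-* x (toℕ u)))
      rearrange : ∀ U x y q → U * x - + 1 ≡ - (+ 1) * ((+ 1 + y * q) - x * U) + + 1 * (y * q - + 0)
      rearrange = solve-∀
  ... | GCD.Bézout.-+ x y eq = residue (- (+ x)) , ≋-trans (≋-* (≋-refl {ι u}) (ι-residue (- (+ x)))) by-eq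
    where
    by-eq : ι u * - (+ x) ≋ + 1
    by-eq = combine₂ (- (+ 1)) (- (+ 1)) (≋-reflexive (lift eq)) (multiple≋0 (+ y)) (rearrange (ι u) (+ x) (+ y) (+ p))
      where
      lift : 1 Nat.+ x Nat.* toℕ u ≡ y Nat.* p → + 1 + + x * ι u ≡ + y * + p
      lift e = trans (sym (trans (ℤₚ.pos-+ 1 _) (cong (λ t → + 1 + t) (ℤₚ.pos-* x (toℕ u)))))
                     (trans (cong +_ e) (ℤₚ.pos-* y p))
      rearrange : ∀ U x y q → U * - x - + 1 ≡ - (+ 1) * ((+ 1 + x * U) - y * q) + - (+ 1) * (y * q - + 0)
      rearrange = solve-∀

  invSearch-finds : ∀ u ws → Any (λ w → toℕ (u ⊗ w) ≡ toℕ ⟦ 1 ⟧) ws →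
                    toℕ (u ⊗ invSearch p u ws) ≡ toℕ ⟦ 1 ⟧
  invSearch-finds u (w ∷ ws) found with toℕ (u ⊗ w) Nat.≟ toℕ ⟦ 1 ⟧
  ... | yes hit = hit
  invSearch-finds u (w ∷ ws) (here hit) | no miss = ⊥-elim (miss hit)
  invSearch-finds u (w ∷ ws) (there found) | no miss = invSearch-finds u ws found

  inv-correct : ∀ u → ¬ isZero p u → ι u * ι (inv p u) ≋ + 1
  inv-correct u u≢0 with inverse-exists u u≢0
  ... | w , uw≋1 =
    ≋-trans (≋-sym (ι-⊗ u _)) (≋-trans (≋-reflexive (cong +_ (invSearch-finds u (allFin p) w-found))) (ι-⟦⟧ 1))
    where
    w-is-inverse : u ⊗ w ≡ ⟦ 1 ⟧
    w-is-inverse = ι-injective (≋-trans (ι-⊗ u w) (≋-trans uw≋1 (≋-sym (ι-⟦⟧ 1))))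
    w-found : Any (λ w → toℕ (u ⊗ w) ≡ toℕ ⟦ 1 ⟧) (allFin p)
    w-found = Any.map (λ { refl → cong toℕ w-is-inverse }) (∈-allFin w)

module Counting where
  open import Data.Nat using (_+_; z≤n; s≤s)
  open import Algebra.Properties.CommutativeMonoid.Sum ℕₚ.+-0-commutativeMonoid
    using (sum; sum-cong-≗; ∑-comm; ∑-distrib-+; sum-permute) public
  open import Data.Fin.Permutation using (permutation)

  𝟙 : ∀ {a} {A : Set a} → Dec A → ℕ
  𝟙 (yes _) = 1
  𝟙 (no _) = 0

  𝟙-yes : ∀ {a} {A : Set a} (d : Dec A) → A → 𝟙 d ≡ 1
  𝟙-yes (yes _) _ = refl
  𝟙-yes (no ¬a) a = ⊥-elim (¬a a)

  𝟙-no : ∀ {a} {A : Set a} (d : Dec A) → ¬ A → 𝟙 d ≡ 0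
  𝟙-no (yes a) ¬a = ⊥-elim (¬a a)
  𝟙-no (no _) _ = refl

  𝟙-witness : ∀ {a} {A : Set a} (d : Dec A) → 𝟙 d ≡ 1 → A
  𝟙-witness (yes a) _ = a

  𝟙-⇔ : ∀ {a b} {A : Set a} {B : Set b} → (A → B) → (B → A) → (dA : Dec A) (dB : Dec B) → 𝟙 dA ≡ 𝟙 dB
  𝟙-⇔ f g (yes a) dB = sym (𝟙-yes dB (f a))
  𝟙-⇔ f g (no ¬a) dB = sym (𝟙-no dB (¬a ∘ g))

  𝟙-split : ∀ {a b} {A : Set a} {B : Set b} (dA : Dec A) (dB : Dec B) →
            𝟙 dA ≡ 𝟙 (dA ×-dec dB) + 𝟙 (dA ×-dec ¬? dB)
  𝟙-split (yes _) (yes _) = refl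
  𝟙-split (yes _) (no _) = refl
  𝟙-split (no _) _ = refl

  𝟙-complement : ∀ {a} {A : Set a} (d : Dec A) → 𝟙 d + 𝟙 (¬? d) ≡ 1
  𝟙-complement (yes _) = refl
  𝟙-complement (no _) = refl

  𝟙-×≤ : ∀ {a b} {A : Set a} {B : Set b} (dA : Dec A) (dB : Dec B) → 𝟙 (dA ×-dec dB) ≤ 𝟙 dB
  𝟙-×≤ (yes _) (yes _) = s≤s z≤n
  𝟙-×≤ (no _) _ = z≤n
  𝟙-×≤ (yes _) (no _) = z≤n

  sum-zero : ∀ {n} {f : Fin n → ℕ} → (∀ i → f i ≡ 0) → sum f ≡ 0
  sum-zero {Nat.zero} h = refl
  sum-zero {Nat.suc n} h = cong₂ _+_ (h zero) (sum-zero (h ∘ suc))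

  sum-single : ∀ {n} {f : Fin n → ℕ} (j : Fin n) → (∀ i → i ≢ j → f i ≡ 0) → sum f ≡ f j
  sum-single {Nat.suc n} {f} zero h =
    trans (cong (λ t → f zero + t) (sum-zero (λ i → h (suc i) (λ ())))) (ℕₚ.+-identityʳ _)
  sum-single {Nat.suc n} (suc j) h =
    cong₂ _+_ (h zero (λ ())) (sum-single j (λ i i≢j → h (suc i) (i≢j ∘ Finₚ.suc-injective)))

  sum-ones : ∀ n → sum {n} (λ _ → 1) ≡ n
  sum-ones Nat.zero = refl
  sum-ones (Nat.suc n) = cong Nat.suc (sum-ones n)

  sum-mono : ∀ {n} {f g : Fin n → ℕ} → (∀ i → f i ≤ g i) → sum f ≤ sum g
  sum-mono {Nat.zero} h = z≤n
  sum-mono {Nat.suc n} h = ℕₚ.+-mono-≤ (h zero) (sum-mono (h ∘ suc))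

  sum-tight : ∀ {n} {f g : Fin n → ℕ} → (∀ i → f i ≤ g i) → sum f ≡ sum g → ∀ i → f i ≡ g i
  sum-tight {Nat.suc n} {f} {g} f≤g same = pointwise
    where
    head≡ : f zero ≡ g zero
    head≡ = ℕₚ.≤-antisym (f≤g zero)
      (ℕₚ.+-cancelʳ-≤ _ _ _ (ℕₚ.≤-trans (ℕₚ.≤-reflexive (sym same))
                                        (ℕₚ.+-monoʳ-≤ (f zero) (sum-mono (f≤g ∘ suc)))))
    tail≡ : sum (f ∘ suc) ≡ sum (g ∘ suc)
    tail≡ = ℕₚ.+-cancelˡ-≡ (f zero) _ _ (trans same (cong (λ t → t + sum (g ∘ suc)) (sym head≡)))
    pointwise : ∀ i → f i ≡ g i
    pointwise zero = head≡
    pointwise (suc i) = sum-tight (f≤g ∘ suc) tail≡ i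

  count-unique : ∀ {n} {P : Fin n → Set} (P? : ∀ i → Dec (P i)) → (∀ i j → P i → P j → i ≡ j) →
                 sum (λ i → 𝟙 (P? i)) ≤ 1
  count-unique P? unique with Finₚ.any? P?
  ... | yes (j , Pj) =
    ℕₚ.≤-reflexive (trans (sum-single j (λ i i≢j → 𝟙-no (P? i) (λ Pi → i≢j (unique i j Pi Pj))))
                          (𝟙-yes (P? j) Pj))
  ... | no none = ℕₚ.≤-trans (ℕₚ.≤-reflexive (sum-zero (λ i → 𝟙-no (P? i) (λ Pi → none (i , Pi))))) z≤n

  sum-reindex : ∀ {n} (f : Fin n → ℕ) (σ τ : Fin n → Fin n) →
                (∀ x → σ (τ x) ≡ x) → (∀ x → τ (σ x) ≡ x) →
                sum (f ∘ σ) ≡ sum f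
  sum-reindex f σ τ στ τσ = sym (sum-permute f (permutation σ τ στ τσ))

  count-tabulate : ∀ {A : Set} {P : A → Set} (P? : ∀ x → Dec (P x)) {n} (g : Fin n → A) →
                   length (filter P? (tabulate g)) ≡ sum (λ i → 𝟙 (P? (g i)))
  count-tabulate P? {Nat.zero} g = refl
  count-tabulate P? {Nat.suc n} g with P? (g zero)
  ... | yes _ = cong Nat.suc (count-tabulate P? (g ∘ suc))
  ... | no _ = count-tabulate P? (g ∘ suc)

  count-pairs : ∀ {A : Set} {P : A → Set} (P? : ∀ x → Dec (P x)) {n} (g : Fin n → Fin n → A) →
                length (filter P? (concatMap (λ x → map (g x) (allFin n)) (allFin n))) ≡
                sum (λ x → sum (λ y → 𝟙 (P? (g x y))))
  count-pairs P? {n} g = rows n id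
    where
    row : ∀ x → length (filter P? (map (g x) (allFin n))) ≡ sum (λ y → 𝟙 (P? (g x y)))
    row x = trans (cong (length ∘ filter P?) (Listₚ.map-tabulate id (g x))) (count-tabulate P? (g x))
    rows : ∀ k (h : Fin k → Fin n) →
           length (filter P? (concatMap (λ x → map (g x) (allFin n)) (tabulate h))) ≡
           sum (λ i → sum (λ y → 𝟙 (P? (g (h i) y))))
    rows Nat.zero h = refl
    rows (Nat.suc k) h =
      trans (cong length (Listₚ.filter-++ P? (map (g (h zero)) (allFin n)) _))
        (trans (Listₚ.length-++ (filter P? (map (g (h zero)) (allFin n))))
               (cong₂ _+_ (row (h zero)) (rows k (h ∘ suc))))

module Squares (p : ℕ) .{{_ : NonZero p}} (p-prime : Prime p) (odd : p ≢ 2) where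
  open Residues p
  open PrimeField p p-prime
  open Counting
  open import Data.Integer using (_+_; _*_; _-_)

  IsSquare : ZMod p → Set
  IsSquare d = Σ (ZMod p) (λ z → sq p z ≡ d)

  square? : ∀ d → Dec (IsSquare d)
  square? d = Finₚ.any? (λ z → sq p z Finₚ.≟ d)

  sqrtCount : ZMod p → ℕ
  sqrtCount d = sum (λ z → 𝟙 (sq p z Finₚ.≟ d))

  root≉0 : ∀ {d z} → sq p z ≡ d → ¬ (ι d ≋ + 0) → ¬ (ι z ≋ + 0)
  root≉0 {d} {z} z²≡d d≉0 z≋0 =
    d≉0 (≋-trans (≋-reflexive (cong ι (sym z²≡d)))
                 (≋-trans (ι-sq z) (≋-trans (≋-* z≋0 z≋0) (≋-reflexive refl))))

  square≋0 : ∀ {z} → ι z * ι z ≋ + 0 → ι z ≋ + 0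
  square≋0 h with integral h
  ... | inj₁ z≋0 = z≋0
  ... | inj₂ z≋0 = z≋0

  sqrtCount-zero : ∀ d → ι d ≋ + 0 → sqrtCount d ≡ 1
  sqrtCount-zero d d≋0 =
    trans (sum-single d (λ z z≢d → 𝟙-no (sq p z Finₚ.≟ d) (z≢d ∘ only-root z)))
          (𝟙-yes (sq p d Finₚ.≟ d) (ι-injective (≋-trans (ι-sq d) (≋-trans (≋-* d≋0 d≋0) (≋-sym d≋0)))))
    where
    only-root : ∀ z → sq p z ≡ d → z ≡ d
    only-root z z²≡d = ι-injective (≋-trans (square≋0 z²≋0) (≋-sym d≋0))
      where
      z²≋0 : ι z * ι z ≋ + 0
      z²≋0 = ≋-trans (≋-sym (ι-sq z)) (≋-trans (≋-reflexive (cong ι z²≡d)) d≋0)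

  sqrtCount-nonsquare : ∀ d → ¬ IsSquare d → sqrtCount d ≡ 0
  sqrtCount-nonsquare d nonsquare = sum-zero (λ z → 𝟙-no (sq p z Finₚ.≟ d) (λ z²≡d → nonsquare (z , z²≡d)))

  neg : ZMod p → ZMod p
  neg x = 𝟘 ⊖ x

  ι-neg : ∀ x → ι (neg x) ≋ - ι x
  ι-neg x = ≋-trans (ι-⊖ 𝟘 x) (combine₁ (+ 1) ι𝟘 (certificate (ι 𝟘) (ι x)))
    where
    certificate : ∀ o x → (o - x) - - x ≡ + 1 * (o - + 0)
    certificate = solve-∀

  sqrtCount-nonzero-square : ∀ d z₀ → sq p z₀ ≡ d → ¬ (ι z₀ ≋ + 0) → sqrtCount d ≡ 2
  sqrtCount-nonzero-square d z₀ z₀²≡d z₀≉0 =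
    trans (sum-cong-≗ (λ z → 𝟙-split (is-root z) (z Finₚ.≟ z₀)))
      (trans (∑-distrib-+ (λ z → 𝟙 (is-root z ×-dec (z Finₚ.≟ z₀)))
                          (λ z → 𝟙 (is-root z ×-dec ¬? (z Finₚ.≟ z₀))))
             (cong₂ Nat._+_ root-z₀ root-neg-z₀))
    where
    is-root : ∀ z → Dec (sq p z ≡ d)
    is-root z = sq p z Finₚ.≟ d
    d≋z₀² : ι d ≋ ι z₀ * ι z₀
    d≋z₀² = ≋-trans (≋-reflexive (cong ι (sym z₀²≡d))) (ι-sq z₀)
    neg-z₀-root : sq p (neg z₀) ≡ d
    neg-z₀-root = ι-injective (≋-trans (ι-sq (neg z₀))
      (≋-trans (≋-* (ι-neg z₀) (ι-neg z₀)) (combine₁ (- (+ 1)) d≋z₀² (certificate (ι z₀) (ι d)))))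
      where
      certificate : ∀ z d → (- z) * (- z) - d ≡ - (+ 1) * (d - z * z)
      certificate = solve-∀
    -- z₀ ≠ -z₀, since 2z₀ ≉ 0
    distinct : neg z₀ ≢ z₀
    distinct e = nonzero-* (two≉0 odd) z₀≉0 (combine₁ (- (+ 1)) -z₀≋z₀ (certificate (ι z₀)))
      where
      -z₀≋z₀ : - ι z₀ ≋ ι z₀
      -z₀≋z₀ = ≋-trans (≋-sym (ι-neg z₀)) (≋-reflexive (cong ι e))
      certificate : ∀ z → + 2 * z - + 0 ≡ - (+ 1) * ((- z) - z)
      certificate = solve-∀
    -- z² = z₀² forces (z - z₀)(z + z₀) = 0
    other-root : ∀ z → sq p z ≡ d → z ≢ z₀ → z ≡ neg z₀
    other-root z z²≡d z≢z₀ =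
      by-factor (integral {ι z - ι z₀} {ι z + ι z₀} (combine₁ (+ 1) z²≋z₀² (factor (ι z) (ι z₀))))
      where
      z²≋z₀² : ι z * ι z ≋ ι z₀ * ι z₀
      z²≋z₀² = ≋-trans (≋-sym (ι-sq z)) (≋-trans (≋-reflexive (cong ι z²≡d)) d≋z₀²)
      factor : ∀ z w → (z - w) * (z + w) - + 0 ≡ + 1 * (z * z - w * w)
      factor = solve-∀
      minus : ∀ z w → z - w ≡ + 1 * (z - w - + 0)
      minus = solve-∀
      plus : ∀ z w → z - - w ≡ + 1 * (z + w - + 0)
      plus = solve-∀
      by-factor : ι z - ι z₀ ≋ + 0 ⊎ ι z + ι z₀ ≋ + 0 → z ≡ neg z₀
      by-factor (inj₁ h) = ⊥-elim (z≢z₀ (ι-injective (combine₁ (+ 1) h (minus (ι z) (ι z₀)))))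
      by-factor (inj₂ h) = ι-injective (≋-trans (combine₁ (+ 1) h (plus (ι z) (ι z₀))) (≋-sym (ι-neg z₀)))
    root-z₀ : sum (λ z → 𝟙 (is-root z ×-dec (z Finₚ.≟ z₀))) ≡ 1
    root-z₀ = trans (sum-single z₀ (λ z z≢z₀ → 𝟙-no (is-root z ×-dec (z Finₚ.≟ z₀)) (z≢z₀ ∘ proj₂)))
                    (𝟙-yes (is-root z₀ ×-dec (z₀ Finₚ.≟ z₀)) (z₀²≡d , refl))
    root-neg-z₀ : sum (λ z → 𝟙 (is-root z ×-dec ¬? (z Finₚ.≟ z₀))) ≡ 1
    root-neg-z₀ =
      trans (sum-single (neg z₀) (λ z z≢-z₀ → 𝟙-no (is-root z ×-dec ¬? (z Finₚ.≟ z₀))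
                                    (λ { (z²≡d , z≢z₀) → z≢-z₀ (other-root z z²≡d z≢z₀) })))
            (𝟙-yes (is-root (neg z₀) ×-dec ¬? (neg z₀ Finₚ.≟ z₀)) (neg-z₀-root , distinct))

  -- If s² = x·t² with t ≠ 0 then x = (s/t)² is a square.
  square-from-ratio : ∀ x s t → ¬ (ι t ≋ + 0) → ι s * ι s ≋ ι x * (ι t * ι t) → IsSquare x
  square-from-ratio x s t t≉0 s²≋xt² = s ⊗ t⁻¹ , ι-injective
    (≋-trans (ι-sq (s ⊗ t⁻¹)) (≋-trans (≋-* (ι-⊗ s t⁻¹) (ι-⊗ s t⁻¹))
      (combine₂ (ι t⁻¹ * ι t⁻¹) (ι x * (ι t * ι t⁻¹ + + 1)) s²≋xt² (inv-correct t (t≉0 ∘ isZero⇒≋0))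
        (certificate (ι s) (ι t) (ι t⁻¹) (ι x)))))
    where
    t⁻¹ = inv p t
    certificate : ∀ s t t' x → (s * t') * (s * t') - x ≡
      (t' * t') * (s * s - x * (t * t)) + (x * (t * t' + + 1)) * (t * t' - + 1)
    certificate = solve-∀

  legendre-nonresidue : ∀ n → legendre p n ≡ - (+ 1) → ¬ isZero p n × ¬ IsSquare n
  legendre-nonresidue n e with toℕ n Nat.≟ 0
  legendre-nonresidue n () | yes _
  ... | no n≢0 with Finₚ.any? (λ x → toℕ (sq p x) Nat.≟ toℕ n)
  legendre-nonresidue n () | no n≢0 | yes _
  ... | no nonsquare = n≢0 , λ { (z , z²≡n) → nonsquare (z , cong toℕ z²≡n) }

  sq𝟘 : sq p 𝟘 ≡ 𝟘
  sq𝟘 = ι-injective (≋-trans (ι-sq 𝟘) (≋-trans (≋-* ι𝟘 ι𝟘) (≋-sym ι𝟘)))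

  #squares : ℕ
  #squares = sum (λ x → 𝟙 (square? x))

  -- Every z is the root of exactly one d.
  sum-sqrtCount : sum sqrtCount ≡ p
  sum-sqrtCount = trans (∑-comm (λ d z → 𝟙 (sq p z Finₚ.≟ d)))
    (trans (sum-cong-≗ (λ z → trans (sum-single (sq p z) (λ d d≢z² → 𝟙-no (sq p z Finₚ.≟ d) (d≢z² ∘ sym)))
                                   (𝟙-yes (sq p z Finₚ.≟ sq p z) refl)))
           (sum-ones p))

  sqrtCount-vs-square : ∀ x → sqrtCount x Nat.+ 𝟙 (x Finₚ.≟ 𝟘) ≡ 𝟙 (square? x) Nat.+ 𝟙 (square? x)
  sqrtCount-vs-square x with x Finₚ.≟ 𝟘
  ... | yes refl =
    trans (cong (Nat._+ 1) (sqrtCount-zero 𝟘 ι𝟘)) (cong (λ t → t Nat.+ t) (sym (𝟙-yes (square? 𝟘) (𝟘 , sq𝟘))))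
  ... | no x≢𝟘 with square? x
  ...   | yes (z , z²≡x) =
    trans (ℕₚ.+-identityʳ _) (sqrtCount-nonzero-square x z z²≡x (root≉0 z²≡x (≢𝟘⇒≉0 x≢𝟘)))
  ...   | no nonsquare = trans (ℕₚ.+-identityʳ _) (sqrtCount-nonsquare x nonsquare)

  squares-count : p Nat.+ 1 ≡ #squares Nat.+ #squares
  squares-count = begin
    p Nat.+ 1
      ≡⟨ cong₂ Nat._+_ (sym sum-sqrtCount) (sym one-zero) ⟩
    sum sqrtCount Nat.+ sum (λ x → 𝟙 (x Finₚ.≟ 𝟘))
      ≡⟨ sym (∑-distrib-+ sqrtCount (λ x → 𝟙 (x Finₚ.≟ 𝟘))) ⟩
    sum (λ x → sqrtCount x Nat.+ 𝟙 (x Finₚ.≟ 𝟘))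
      ≡⟨ sum-cong-≗ sqrtCount-vs-square ⟩
    sum (λ x → 𝟙 (square? x) Nat.+ 𝟙 (square? x))
      ≡⟨ ∑-distrib-+ (λ x → 𝟙 (square? x)) (λ x → 𝟙 (square? x)) ⟩
    #squares Nat.+ #squares
      ∎
    where
    open Relation.Binary.PropositionalEquality.≡-Reasoning
    one-zero : sum (λ x → 𝟙 (x Finₚ.≟ 𝟘)) ≡ 1
    one-zero = trans (sum-single 𝟘 (λ x → 𝟙-no (x Finₚ.≟ 𝟘))) (𝟙-yes (𝟘 Finₚ.≟ 𝟘) refl)

  #nonsquares : ℕ
  #nonsquares = sum (λ x → 𝟙 (¬? (square? x)))

  nonsquares-count : 1 Nat.+ #nonsquares ≡ #squares
  nonsquares-count = trans (ℕₚ.+-comm 1 #nonsquares) (ℕₚ.+-cancelˡ-≡ #squares _ _ total)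
    where
    partition : #squares Nat.+ #nonsquares ≡ p
    partition = trans (sym (∑-distrib-+ (λ x → 𝟙 (square? x)) (λ x → 𝟙 (¬? (square? x)))))
                      (trans (sum-cong-≗ (λ x → 𝟙-complement (square? x))) (sum-ones p))
    total : #squares Nat.+ (#nonsquares Nat.+ 1) ≡ #squares Nat.+ #squares
    total = trans (sym (ℕₚ.+-assoc #squares #nonsquares 1)) (trans (cong (Nat._+ 1) partition) squares-count)

  -- Multiplication by the
  -- non-square n permutes Z/pZ, so x ↦ [n·x is a square] sums to #squares;
  -- only x = 0 has both n·x and x square, so the x with n·x square and x not
  -- square number #squares - 1 = #nonsquares, i.e. they are all non-squares.
  nonsquare-product : ∀ n m → ¬ isZero p n → ¬ IsSquare n → ¬ IsSquare m → IsSquare (n ⊗ m)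
  nonsquare-product n m n≢0 n-nonsquare m-nonsquare =
    proj₁ (𝟙-witness (square? (n ⊗ m) ×-dec ¬? (square? m))
            (trans (sum-tight (λ x → 𝟙-×≤ (square? (n ⊗ x)) (¬? (square? x))) T≡U m)
                   (𝟙-yes (¬? (square? m)) m-nonsquare)))
    where
    n⁻¹ = inv p n
    nn⁻¹≋1 : ι n * ι n⁻¹ ≋ + 1
    nn⁻¹≋1 = inv-correct n n≢0
    scale-invertible : ∀ a b → ι a * ι b ≋ + 1 → ∀ x → a ⊗ (b ⊗ x) ≡ x
    scale-invertible a b ab≋1 x =
      ι-injective (≋-trans (ι-⊗ a _) (≋-trans (≋-* (≋-refl {ι a}) (ι-⊗ b x))
                                              (combine₁ (ι x) ab≋1 (certificate (ι a) (ι b) (ι x)))))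
      where
      certificate : ∀ a b x → a * (b * x) - x ≡ x * (a * b - + 1)
      certificate = solve-∀
    n⁻¹n≋1 : ι n⁻¹ * ι n ≋ + 1
    n⁻¹n≋1 = ≋-trans (≋-reflexive (ℤₚ.*-comm (ι n⁻¹) (ι n))) nn⁻¹≋1
    scaled-squares : sum (λ x → 𝟙 (square? (n ⊗ x))) ≡ #squares
    scaled-squares = sum-reindex (λ x → 𝟙 (square? x)) (n ⊗_) (n⁻¹ ⊗_)
      (scale-invertible n n⁻¹ nn⁻¹≋1) (scale-invertible n⁻¹ n n⁻¹n≋1)
    -- n·x and x both squares forces x = 0
    both-squares : sum (λ x → 𝟙 (square? (n ⊗ x) ×-dec square? x)) ≡ 1
    both-squares = trans (sum-single 𝟘 (λ x x≢𝟘 → 𝟙-no (square? (n ⊗ x) ×-dec square? x) (only-zero x x≢𝟘)))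
                         (𝟙-yes (square? (n ⊗ 𝟘) ×-dec square? 𝟘) ((𝟘 , n𝟘≡𝟘) , (𝟘 , sq𝟘)))
      where
      n𝟘≡𝟘 : sq p 𝟘 ≡ n ⊗ 𝟘
      n𝟘≡𝟘 = trans sq𝟘 (ι-injective (≋-sym (≋-trans (ι-⊗ n 𝟘)
               (≋-trans (≋-* (≋-refl {ι n}) ι𝟘) (≋-trans (≋-reflexive (ℤₚ.*-zeroʳ (ι n))) (≋-sym ι𝟘))))))
      only-zero : ∀ x → x ≢ 𝟘 → ¬ (IsSquare (n ⊗ x) × IsSquare x)
      only-zero x x≢𝟘 ((s , s²≡nx) , (t , t²≡x)) =
        n-nonsquare (square-from-ratio n s t (root≉0 t²≡x (≢𝟘⇒≉0 x≢𝟘)) s²≋nt²)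
        where
        s²≋nt² : ι s * ι s ≋ ι n * (ι t * ι t)
        s²≋nt² = ≋-trans (≋-sym (ι-sq s)) (≋-trans (≋-reflexive (cong ι s²≡nx)) (≋-trans (ι-⊗ n x)
                   (≋-* (≋-refl {ι n}) (≋-trans (≋-reflexive (cong ι (sym t²≡x))) (ι-sq t)))))
    T U : ℕ
    T = sum (λ x → 𝟙 (square? (n ⊗ x) ×-dec ¬? (square? x)))
    U = #nonsquares
    T≡U : T ≡ U
    T≡U = ℕₚ.+-cancelˡ-≡ 1 T U (trans one+T (sym nonsquares-count))
      where
      one+T : 1 Nat.+ T ≡ #squares
      one+T = trans (cong (Nat._+ T) (sym both-squares))
        (trans (sym (∑-distrib-+ (λ x → 𝟙 (square? (n ⊗ x) ×-dec square? x))
                                 (λ x → 𝟙 (square? (n ⊗ x) ×-dec ¬? (square? x)))))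
               (trans (sum-cong-≗ (λ x → sym (𝟙-split (square? (n ⊗ x)) (square? x)))) scaled-squares))

  -- If d·d′ = n·t² with n a non-square and d, d′, t nonzero, then exactly one
  -- of d, d′ is a (nonzero) square, so together they have two square roots.
  complementary-sqrtCounts : ∀ d d′ n t → ¬ isZero p n → ¬ IsSquare n →
    ¬ (ι d ≋ + 0) → ¬ (ι d′ ≋ + 0) → ¬ (ι t ≋ + 0) →
    ι d * ι d′ ≋ ι n * (ι t * ι t) → sqrtCount d Nat.+ sqrtCount d′ ≡ 2
  complementary-sqrtCounts d d′ n t n≢0 n-nonsquare d≉0 d′≉0 t≉0 dd′≋nt² with square? d
  ... | yes (z , z²≡d) = cong₂ Nat._+_ (sqrtCount-nonzero-square d z z²≡d (root≉0 z²≡d d≉0))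
                                       (sqrtCount-nonsquare d′ d′-nonsquare)
    where
    -- if d′ = w² then (z·w)² = n·t²
    d′-nonsquare : ¬ IsSquare d′
    d′-nonsquare (w , w²≡d′) = n-nonsquare (square-from-ratio n (z ⊗ w) t t≉0
      (≋-trans (≋-* (ι-⊗ z w) (ι-⊗ z w))
        (combine₃ (ι w * ι w) (ι d) (+ 1) (≋-trans (≋-sym (ι-sq z)) (≋-reflexive (cong ι z²≡d)))
                  (≋-trans (≋-sym (ι-sq w)) (≋-reflexive (cong ι w²≡d′))) dd′≋nt²
                  (certificate (ι z) (ι w) (ι d) (ι d′) (ι n) (ι t)))))
      where
      certificate : ∀ z w d d′ n t → (z * w) * (z * w) - n * (t * t) ≡
        (w * w) * (z * z - d) + d * (w * w - d′) + + 1 * (d * d′ - n * (t * t))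
      certificate = solve-∀
  ... | no d-nonsquare = cong₂ Nat._+_ (sqrtCount-nonsquare d d-nonsquare)
                                       (sqrtCount-nonzero-square d′ w w²≡d′ (root≉0 w²≡d′ d′≉0))
    where
    -- n·d = s² (product of non-squares), so d′·s² = n·d·d′ = (n·t)²
    nd-square : IsSquare (n ⊗ d)
    nd-square = nonsquare-product n d n≢0 n-nonsquare d-nonsquare
    s = proj₁ nd-square
    s²≋nd : ι s * ι s ≋ ι n * ι d
    s²≋nd = ≋-trans (≋-sym (ι-sq s)) (≋-trans (≋-reflexive (cong ι (proj₂ nd-square))) (ι-⊗ n d))
    s≉0 : ¬ (ι s ≋ + 0)
    s≉0 s≋0 = nonzero-* (n≢0 ∘ ≋0⇒isZero) d≉0
                (≋-trans (≋-sym s²≋nd) (≋-trans (≋-* s≋0 s≋0) (≋-reflexive refl)))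
    d′-square : IsSquare d′
    d′-square = square-from-ratio d′ (n ⊗ t) s s≉0
      (≋-trans (≋-* (ι-⊗ n t) (ι-⊗ n t))
        (combine₂ (- ι d′) (- ι n) s²≋nd dd′≋nt² (certificate (ι s) (ι d) (ι d′) (ι n) (ι t))))
      where
      certificate : ∀ s d d′ n t → (n * t) * (n * t) - d′ * (s * s) ≡
        (- d′) * (s * s - n * d) + (- n) * (d * d′ - n * (t * t))
      certificate = solve-∀
    w = proj₁ d′-square
    w²≡d′ = proj₂ d′-square

module AffineReindexing (p : ℕ) .{{_ : NonZero p}} (p-prime : Prime p) where
  open Residues p
  open PrimeField p p-prime
  open Counting
  open import Data.Integer using (_+_; _*_; _-_)

  sum-affine : ∀ (f : ZMod p → ℕ) e c → ¬ isZero p e → sum (λ x → f (e ⊗ x ⊕ c)) ≡ sum f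
  sum-affine f e c e≢0 = sum-reindex f σ τ στ τσ
    where
    σ τ : ZMod p → ZMod p
    σ x = e ⊗ x ⊕ c
    τ z = (z ⊖ c) ⊗ inv p e
    E W C : ℤ
    E = ι e
    W = ι (inv p e)
    C = ι c
    eW≋1 : E * W ≋ + 1
    eW≋1 = inv-correct e e≢0
    ι-σ : ∀ x → ι (σ x) ≋ E * ι x + C
    ι-σ x = ≋-trans (ι-⊕ (e ⊗ x) c) (≋-+ (ι-⊗ e x) (≋-refl {C}))
    ι-τ : ∀ z → ι (τ z) ≋ (ι z - C) * W
    ι-τ z = ≋-trans (ι-⊗ (z ⊖ c) (inv p e)) (≋-* (ι-⊖ z c) (≋-refl {W}))
    στ : ∀ z → σ (τ z) ≡ z
    στ z = ι-injective (≋-trans (ι-σ (τ z)) (≋-trans (≋-+ (≋-* (≋-refl {E}) (ι-τ z)) ≋-refl)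
             (combine₁ (ι z - C) eW≋1 (certificate E (ι z) C W))))
      where
      certificate : ∀ e z c w → e * ((z - c) * w) + c - z ≡ (z - c) * (e * w - + 1)
      certificate = solve-∀
    τσ : ∀ x → τ (σ x) ≡ x
    τσ x = ι-injective (≋-trans (ι-τ (σ x)) (≋-trans (≋-* (≋-- (ι-σ x) (≋-refl {C})) ≋-refl)
             (combine₁ (ι x) eW≋1 (certificate E (ι x) C W))))
      where
      certificate : ∀ e x c w → ((e * x + c) - c) * w - x ≡ x * (e * w - + 1)
      certificate = solve-∀

module Parabolas (p : ℕ) .{{_ : NonZero p}} (p-prime : Prime p) (odd : p ≢ 2) where
  open Residues p
  open PrimeField p p-prime
  open Counting
  open Squares p p-prime odd
  open AffineReindexing p p-prime
  open import Data.Integer using (_+_; _*_; _-_)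

  -- Δ u v a x = x²/u - (x - a)²/v, the second coordinate of
  -- (x, x²/u) - (x - a, (x - a)²/v).
  Δ : ZMod p → ZMod p → ZMod p → ZMod p → ZMod p
  Δ u v a x = _/ₚ_ p (sq p x) u ⊖ _/ₚ_ p (sq p (x ⊖ a)) v

  hits : (u v a b x : ZMod p) → Dec (toℕ b ≡ toℕ (Δ u v a x))
  hits u v a b x = toℕ b Nat.≟ toℕ (Δ u v a x)

  -- In a representation (x, y) of (a, b), y = x - a is determined by x.
  r-as-count : ∀ u v a b → r p u v a b ≡ sum (λ x → 𝟙 (hits u v a b x))
  r-as-count u v a b = trans (count-pairs pair? _,_) (sum-cong-≗ row)
    where
    pair? : ∀ (q : ZMod p × ZMod p) → Dec (toℕ a ≡ toℕ (proj₁ q ⊖ proj₂ q) ×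
                                           toℕ b ≡ toℕ (_/ₚ_ p (sq p (proj₁ q)) u ⊖ _/ₚ_ p (sq p (proj₂ q)) v))
    pair? (x , y) = (toℕ a Nat.≟ toℕ (x ⊖ y)) ×-dec (toℕ b Nat.≟ toℕ (_/ₚ_ p (sq p x) u ⊖ _/ₚ_ p (sq p y) v))
    y-forced : ∀ x y → toℕ a ≡ toℕ (x ⊖ y) → y ≡ x ⊖ a
    y-forced x y a≡x-y = ι-injective (≋-trans
      (combine₁ (+ 1) (≋-trans (≋-reflexive (cong +_ a≡x-y)) (ι-⊖ x y)) (certificate (ι x) (ι y) (ι a)))
      (≋-sym (ι-⊖ x a)))
      where
      certificate : ∀ x y a → y - (x - a) ≡ + 1 * (a - (x - y))
      certificate = solve-∀
    x-a-works : ∀ x → toℕ a ≡ toℕ (x ⊖ (x ⊖ a))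
    x-a-works x = cong toℕ (ι-injective (≋-sym (≋-trans (ι-⊖ x (x ⊖ a))
                    (≋-trans (≋-- (≋-refl {ι x}) (ι-⊖ x a)) (combine₀ (certificate (ι x) (ι a)))))))
      where
      certificate : ∀ x a → x - (x - a) - a ≡ + 0
      certificate = solve-∀
    row : ∀ x → sum (λ y → 𝟙 (pair? (x , y))) ≡ 𝟙 (hits u v a b x)
    row x = trans (sum-single (x ⊖ a) (λ y y≢x-a → 𝟙-no (pair? (x , y))
                                                        (λ (a≡x-y , _) → y≢x-a (y-forced x y a≡x-y))))
                  (𝟙-⇔ proj₂ (λ b≡Δ → x-a-works x , b≡Δ) (pair? (x , x ⊖ a)) (hits u v a b x))

  ι-Δ : ∀ u v a x → ι (Δ u v a x) ≋ ι x * ι x * ι (inv p u) - (ι x - ι a) * (ι x - ι a) * ι (inv p v)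
  ι-Δ u v a x = ≋-trans (ι-⊖ (sq p x ⊗ inv p u) (sq p (x ⊖ a) ⊗ inv p v))
    (≋-- (≋-trans (ι-⊗ (sq p x) (inv p u)) (≋-* (ι-sq x) (≋-refl {ι (inv p u)})))
         (≋-trans (ι-⊗ (sq p (x ⊖ a)) (inv p v))
                  (≋-* (≋-trans (ι-sq (x ⊖ a)) (≋-* (ι-⊖ x a) (ι-⊖ x a))) (≋-refl {ι (inv p v)}))))

  hit⇒≋ : (u v a b x : ZMod p) → toℕ b ≡ toℕ (Δ u v a x) →
          ι b ≋ ι x * ι x * ι (inv p u) - (ι x - ι a) * (ι x - ι a) * ι (inv p v)
  hit⇒≋ u v a b x b≡Δ = ≋-trans (≋-reflexive (cong +_ b≡Δ)) (ι-Δ u v a x)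

  ≋⇒hit : (u v a b x : ZMod p) → ι b ≋ ι x * ι x * ι (inv p u) - (ι x - ι a) * (ι x - ι a) * ι (inv p v) →
          toℕ b ≡ toℕ (Δ u v a x)
  ≋⇒hit u v a b x h = cong toℕ (ι-injective (≋-trans h (≋-sym (ι-Δ u v a x))))

  -- Part 1.  For u = v the condition b = Δ is linear in x: 2a·x = a² + b·u.
  r-diagonal : ∀ u a b → ¬ isZero p u → ¬ (isZero p a × isZero p b) → r p u u a b ≤ 1
  r-diagonal u a b u≢0 ab≢0 = ℕₚ.≤-trans (ℕₚ.≤-reflexive (r-as-count u u a b)) (by-a (toℕ a Nat.≟ 0))
    where
    U A B : ℤ
    U = ι u
    A = ι a
    B = ι b
    linear : ∀ x → toℕ b ≡ toℕ (Δ u u a x) → (+ 2 * A) * ι x ≋ A * A + B * U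
    linear x hit = combine₂ (- U) (- (+ 2 * A * ι x - A * A)) (hit⇒≋ u u a b x hit) (inv-correct u u≢0)
                     (certificate (ι x) A B U (ι (inv p u)))
      where
      certificate : ∀ x a b u u′ → (+ 2 * a) * x - (a * a + b * u) ≡
        (- u) * (b - (x * x * u′ - (x - a) * (x - a) * u′)) + (- (+ 2 * a * x - a * a)) * (u * u′ - + 1)
      certificate = solve-∀
    by-a : Dec (isZero p a) → sum (λ x → 𝟙 (hits u u a b x)) ≤ 1
    -- a = 0: the condition reads b·u = 0, impossible since b ≠ 0
    by-a (yes a≡0) = ℕₚ.≤-trans (ℕₚ.≤-reflexive (sum-zero (λ x → 𝟙-no (hits u u a b x) (no-hit x)))) Nat.z≤n
      where
      no-hit : ∀ x → ¬ (toℕ b ≡ toℕ (Δ u u a x))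
      no-hit x hit = nonzero-* (λ b≋0 → ab≢0 (a≡0 , ≋0⇒isZero b≋0)) (u≢0 ∘ ≋0⇒isZero)
        (combine₂ (- (+ 1)) (+ 2 * ι x - A) (linear x hit) (isZero⇒≋0 a≡0) (certificate (ι x) A B U))
        where
        certificate : ∀ x a b u → b * u - + 0 ≡ - (+ 1) * ((+ 2 * a) * x - (a * a + b * u)) + (+ 2 * x - a) * (a - + 0)
        certificate = solve-∀
    -- a ≠ 0: 2a is invertible, so x is unique
    by-a (no a≢0) = count-unique (hits u u a b) (λ x₁ x₂ hit₁ hit₂ →
      ι-injective (cancelˡ (nonzero-* (two≉0 odd) (a≢0 ∘ ≋0⇒isZero))
        (combine₂ (+ 1) (- (+ 1)) (linear x₁ hit₁) (linear x₂ hit₂)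
                  (certificate (+ 2 * A) (ι x₁) (ι x₂) (A * A + B * U)))))
      where
      certificate : ∀ t x₁ x₂ c → t * x₁ - t * x₂ ≡ + 1 * (t * x₁ - c) + - (+ 1) * (t * x₂ - c)
      certificate = solve-∀

  -- d = uv·(a² + b(v - u)); for u ≠ v, r counts the square roots of d.
  disc : ZMod p → ZMod p → ZMod p → ZMod p → ZMod p
  disc u v a b = (u ⊗ v) ⊗ (a ⊗ a ⊕ b ⊗ (v ⊖ u))

  -- Completing the square: with z = (v - u)x + a·u, the condition b = Δ
  -- multiplied by uv(v - u) becomes z² = d.
  r≡sqrtCount : ∀ u v a b → ¬ isZero p u → ¬ isZero p v → ¬ isZero p (v ⊖ u) →
                r p u v a b ≡ sqrtCount (disc u v a b)
  r≡sqrtCount u v a b u≢0 v≢0 v-u≢0 = trans (r-as-count u v a b)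
    (trans (sum-cong-≗ (λ x → 𝟙-⇔ (hit⇒root x) (root⇒hit x) (hits u v a b x) (sq p (σ x) Finₚ.≟ d)))
           (sum-affine (λ z → 𝟙 (sq p z Finₚ.≟ d)) (v ⊖ u) (a ⊗ u) v-u≢0))
    where
    d = disc u v a b
    σ : ZMod p → ZMod p
    σ x = (v ⊖ u) ⊗ x ⊕ a ⊗ u
    U V A B U′ V′ : ℤ
    U = ι u
    V = ι v
    A = ι a
    B = ι b
    U′ = ι (inv p u)
    V′ = ι (inv p v)
    ι-σ : ∀ x → ι (σ x) ≋ (V - U) * ι x + A * U
    ι-σ x = ≋-trans (ι-⊕ ((v ⊖ u) ⊗ x) (a ⊗ u))
                    (≋-+ (≋-trans (ι-⊗ (v ⊖ u) x) (≋-* (ι-⊖ v u) (≋-refl {ι x}))) (ι-⊗ a u))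
    ι-d : ι d ≋ U * V * (A * A + B * (V - U))
    ι-d = ≋-trans (ι-⊗ (u ⊗ v) _) (≋-* (ι-⊗ u v)
            (≋-trans (ι-⊕ (a ⊗ a) (b ⊗ (v ⊖ u)))
                     (≋-+ (ι-⊗ a a) (≋-trans (ι-⊗ b (v ⊖ u)) (≋-* (≋-refl {B}) (ι-⊖ v u))))))
    -- σ(x)² - d = -uv(v - u)·(b - Δ) up to the relations u·u⁻¹ = 1 = v·v⁻¹
    certificate : ∀ x a u v u′ v′ b →
      ((v - u) * x + a * u) * ((v - u) * x + a * u) - u * v * (a * a + b * (v - u)) ≡
      (- (u * v * (v - u))) * (b - (x * x * u′ - (x - a) * (x - a) * v′)) +
      (- (v * (v - u) * x * x)) * (u * u′ - + 1) + (u * (v - u) * (x - a) * (x - a)) * (v * v′ - + 1)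
    certificate = solve-∀
    hit⇒root : ∀ x → toℕ b ≡ toℕ (Δ u v a x) → sq p (σ x) ≡ d
    hit⇒root x hit = ι-injective (≋-trans (ι-sq (σ x)) (≋-trans (≋-* (ι-σ x) (ι-σ x))
      (≋-trans (combine₃ (- (U * V * (V - U))) (- (V * (V - U) * ι x * ι x)) (U * (V - U) * (ι x - A) * (ι x - A))
                         (hit⇒≋ u v a b x hit) (inv-correct u u≢0) (inv-correct v v≢0)
                         (certificate (ι x) A U V U′ V′ B))
               (≋-sym ι-d))))
    root⇒hit : ∀ x → sq p (σ x) ≡ d → toℕ b ≡ toℕ (Δ u v a x)
    root⇒hit x root = ≋⇒hit u v a b x (cancelˡ uv[v-u]≉0
      (combine₃ (- (+ 1)) (- (V * (V - U) * ι x * ι x)) (U * (V - U) * (ι x - A) * (ι x - A))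
                σ²≋d (inv-correct u u≢0) (inv-correct v v≢0) (rearranged (ι x) A U V U′ V′ B)))
      where
      uv[v-u]≉0 : ¬ (U * V * (V - U) ≋ + 0)
      uv[v-u]≉0 = nonzero-* (nonzero-* (u≢0 ∘ ≋0⇒isZero) (v≢0 ∘ ≋0⇒isZero))
                            (λ h → v-u≢0 (≋0⇒isZero (≋-trans (ι-⊖ v u) h)))
      σ²≋d : ((V - U) * ι x + A * U) * ((V - U) * ι x + A * U) ≋ U * V * (A * A + B * (V - U))
      σ²≋d = ≋-trans (≋-sym (≋-* (ι-σ x) (ι-σ x)))
                     (≋-trans (≋-sym (ι-sq (σ x))) (≋-trans (≋-reflexive (cong ι root)) ι-d))
      rearranged : ∀ x a u v u′ v′ b →
        u * v * (v - u) * b - u * v * (v - u) * (x * x * u′ - (x - a) * (x - a) * v′) ≡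
        - (+ 1) * (((v - u) * x + a * u) * ((v - u) * x + a * u) - u * v * (a * a + b * (v - u))) +
        (- (v * (v - u) * x * x)) * (u * u′ - + 1) + (u * (v - u) * (x - a) * (x - a)) * (v * v′ - + 1)
      rearranged = solve-∀

  ι-product : ∀ u v u′ v′ → ι (((u ⊗ v) ⊗ u′) ⊗ v′) ≋ ι u * ι v * ι u′ * ι v′
  ι-product u v u′ v′ = ≋-trans (ι-⊗ ((u ⊗ v) ⊗ u′) v′)
    (≋-* (≋-trans (ι-⊗ (u ⊗ v) u′) (≋-* (ι-⊗ u v) (≋-refl {ι u′}))) (≋-refl {ι v′}))

  gap-swap : ∀ u v u′ v′ → u ⊖ v ≡ u′ ⊖ v′ → v′ ⊖ u′ ≡ v ⊖ u
  gap-swap u v u′ v′ same-gap = ι-injective (≋-trans (ι-⊖ v′ u′) (≋-trans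
    (combine₁ (+ 1) (≋-trans (≋-sym (ι-⊖ u v)) (≋-trans (≋-reflexive (cong ι same-gap)) (ι-⊖ u′ v′)))
              (certificate (ι u) (ι v) (ι u′) (ι v′)))
    (≋-sym (ι-⊖ v u))))
    where
    certificate : ∀ u v u′ v′ → (v′ - u′) - (v - u) ≡ + 1 * ((u - v) - (u′ - v′))
    certificate = solve-∀

  -- If u - v = u′ - v′ and uvu′v′ is a non-square then u ≠ v: otherwise
  -- also u′ = v′ and uvu′v′ = (uu′)².
  gap-nonzero : ∀ u v u′ v′ → u ⊖ v ≡ u′ ⊖ v′ → ¬ IsSquare (((u ⊗ v) ⊗ u′) ⊗ v′) →
                ¬ isZero p (v ⊖ u)
  gap-nonzero u v u′ v′ same-gap nonsquare v-u≡0 = nonsquare (u ⊗ u′ , ι-injective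
    (≋-trans (ι-sq (u ⊗ u′)) (≋-trans (≋-* (ι-⊗ u u′) (ι-⊗ u u′))
      (≋-trans (combine₂ (- (U * U′ * U′)) (- (U * U′ * V)) v≋u v′≋u′ (certificate U V U′ V′))
               (≋-sym (ι-product u v u′ v′))))))
    where
    U V U′ V′ : ℤ
    U = ι u
    V = ι v
    U′ = ι u′
    V′ = ι v′
    v≋u : V - U ≋ + 0
    v≋u = ≋-trans (≋-sym (ι-⊖ v u)) (isZero⇒≋0 v-u≡0)
    v′≋u′ : V′ - U′ ≋ + 0
    v′≋u′ = ≋-trans (≋-sym (ι-⊖ v′ u′))
                    (≋-trans (≋-reflexive (cong ι (gap-swap u v u′ v′ same-gap))) (isZero⇒≋0 v-u≡0))
    certificate : ∀ u v u′ v′ → (u * u′) * (u * u′) - u * v * u′ * v′ ≡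
      (- (u * u′ * u′)) * ((v - u) - + 0) + (- (u * u′ * v)) * ((v′ - u′) - + 0)
    certificate = solve-∀

  -- Part 2.  Both pairs share v - u, hence c = a² + b(v - u); the two counts
  -- are the numbers of square roots of uv·c and u′v′·c.
  r-complementary : ∀ u v u′ v′ → ¬ isZero p u → ¬ isZero p v → ¬ isZero p u′ → ¬ isZero p v′ →
    u ⊖ v ≡ u′ ⊖ v′ → legendre p (((u ⊗ v) ⊗ u′) ⊗ v′) ≡ - (+ 1) →
    ∀ a b → r p u v a b Nat.+ r p u′ v′ a b ≡ 2
  r-complementary u v u′ v′ u≢0 v≢0 u′≢0 v′≢0 same-gap nonresidue a b =
    trans (cong₂ Nat._+_ (r≡sqrtCount u v a b u≢0 v≢0 v-u≢0)
                         (trans (r≡sqrtCount u′ v′ a b u′≢0 v′≢0 v′-u′≢0)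
                                (cong (λ g → sqrtCount ((u′ ⊗ v′) ⊗ (a ⊗ a ⊕ b ⊗ g))) same-gap′)))
          (by-c (toℕ c Nat.≟ 0))
    where
    n = ((u ⊗ v) ⊗ u′) ⊗ v′
    n≢0 = proj₁ (legendre-nonresidue n nonresidue)
    n-nonsquare = proj₂ (legendre-nonresidue n nonresidue)
    v-u≢0 : ¬ isZero p (v ⊖ u)
    v-u≢0 = gap-nonzero u v u′ v′ same-gap n-nonsquare
    same-gap′ : v′ ⊖ u′ ≡ v ⊖ u
    same-gap′ = gap-swap u v u′ v′ same-gap
    v′-u′≢0 : ¬ isZero p (v′ ⊖ u′)
    v′-u′≢0 = subst (λ g → ¬ isZero p g) (sym same-gap′) v-u≢0
    c = a ⊗ a ⊕ b ⊗ (v ⊖ u)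
    by-c : Dec (isZero p c) → sqrtCount ((u ⊗ v) ⊗ c) Nat.+ sqrtCount ((u′ ⊗ v′) ⊗ c) ≡ 2
    by-c (yes c≡0) = cong₂ Nat._+_ (sqrtCount-zero _ (times-zero (u ⊗ v))) (sqrtCount-zero _ (times-zero (u′ ⊗ v′)))
      where
      times-zero : ∀ w → ι (w ⊗ c) ≋ + 0
      times-zero w = ≋-trans (ι-⊗ w c)
                             (≋-trans (≋-* (≋-refl {ι w}) (isZero⇒≋0 c≡0)) (≋-reflexive (ℤₚ.*-zeroʳ (ι w))))
    by-c (no c≢0) = complementary-sqrtCounts d d′ n c n≢0 n-nonsquare
                      (nonzero-scaled u v u≢0 v≢0) (nonzero-scaled u′ v′ u′≢0 v′≢0) (c≢0 ∘ ≋0⇒isZero) dd′≋nc²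
      where
      d = (u ⊗ v) ⊗ c
      d′ = (u′ ⊗ v′) ⊗ c
      ι-scaled : ∀ s t → ι ((s ⊗ t) ⊗ c) ≋ ι s * ι t * ι c
      ι-scaled s t = ≋-trans (ι-⊗ (s ⊗ t) c) (≋-* (ι-⊗ s t) (≋-refl {ι c}))
      nonzero-scaled : ∀ s t → ¬ isZero p s → ¬ isZero p t → ¬ (ι ((s ⊗ t) ⊗ c) ≋ + 0)
      nonzero-scaled s t s≢0 t≢0 h =
        nonzero-* (nonzero-* (s≢0 ∘ ≋0⇒isZero) (t≢0 ∘ ≋0⇒isZero)) (c≢0 ∘ ≋0⇒isZero)
                  (≋-trans (≋-sym (ι-scaled s t)) h)
      dd′≋nc² : ι d * ι d′ ≋ ι n * (ι c * ι c)
      dd′≋nc² = ≋-trans (≋-* (ι-scaled u v) (ι-scaled u′ v′))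
        (≋-trans (combine₀ (certificate (ι u) (ι v) (ι u′) (ι v′) (ι c)))
                 (≋-* (≋-sym (ι-product u v u′ v′)) (≋-refl {ι c * ι c})))
        where
        certificate : ∀ u v u′ v′ c → (u * v * c) * (u′ * v′ * c) - (u * v * u′ * v′) * (c * c) ≡ + 0
        certificate = solve-∀

lemma4p5 : (p : ℕ) .{{_ : NonZero p}} → Prime p → p ≢ 2 →
    ((u v a b : ZMod p) → ¬ isZero p u → ¬ isZero p v →
      ¬ (isZero p a × isZero p b) → u ≡ v → r p u v a b ≤ 1)
    ×
    ((u v u′ v′ : ZMod p) → ¬ isZero p u → ¬ isZero p v →
      ¬ isZero p u′ → ¬ isZero p v′ →
      _-ₚ_ p u v ≡ _-ₚ_ p u′ v′ →
      legendre p (_*ₚ_ p (_*ₚ_ p (_*ₚ_ p u v) u′) v′) ≡ - (+ 1) →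
      (a b : ZMod p) → ¬ (isZero p a × isZero p b) →
      r p u v a b Data.Nat.+ r p u′ v′ a b ≡ 2)
lemma4p5 p p-prime odd =
  (λ { u .u a b u≢0 _ ab≢0 refl → r-diagonal u a b u≢0 ab≢0 }) ,
  -- the count identity of part 2 holds for (a, b) = (0, 0) as well
  (λ u v u′ v′ u≢0 v≢0 u′≢0 v′≢0 same-gap nonresidue a b _ →
     r-complementary u v u′ v′ u≢0 v≢0 u′≢0 v′≢0 same-gap nonresidue a b)
  where
  open Parabolas p p-prime odd
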